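{- If $T$ is a tree, then $\chi_\mu(T)=\mathrm{rad}(T)+1$ if $\mathrm{diam}(T)$ is even, and $\chi_\mu(T)=\mathrm{rad}(T)$ if $\mathrm{diam}(T)$ is odd.
   Context: $\mathrm{rad}(T)$ and $\mathrm{diam}(T)$ are the radius and diameter. For a connected graph $G$ and $S\subseteq V(G)$, two vertices $x,y\in S$ are $S$-visible if there is a shortest $x,y$-path $P$ in $G$ with $V(P)\cap S=\{x,y\}$. $S$ is a mutual-visibility set if any two vertices of $S$ are $S$-visible. A mutual-visibility coloring of $G$ is a partition of $V(G)$ into mutual-visibility sets, and the mutual-visibility chromatic number $\chi_\mu(G)$ is the smallest number of classes in such a partition. -}

module Defs where

open import Level using (0ℓ)
open import Data.Nat using (ℕ; zero; suc; _≤_; _%_)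
open import Data.Fin using (Fin)
open import Data.List using (List; []; _∷_; length)
open import Data.List.Membership.Propositional using (_∈_)
open import Data.List.Relation.Unary.Unique.Propositional using (Unique)
open import Data.Product using (Σ; ∃; _×_; _,_)
open import Data.Sum using (_⊎_)
open import Relation.Nullary using (¬_)
open import Relation.Binary.PropositionalEquality using (_≡_)

record Graph (n : ℕ) : Set₁ where
  field
    Adj    : Fin n → Fin n → Set
    sym    : ∀ {x y} → Adj x y → Adj y x
    irrefl : ∀ {x} → ¬ Adj x x

module _ {n : ℕ} (G : Graph n) where
  open Graph G

  -- Walk x y vs : vs is the vertex sequence of a walk from x to y
  -- (a walk with vertex list vs has length (length vs - 1)).
  data Walk : Fin n → Fin n → List (Fin n) → Set where
    here : ∀ {x} → Walk x x (x ∷ [])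
    step : ∀ {x y z vs} → Adj x y → Walk y z vs → Walk x z (x ∷ vs)

  Connected : Set
  Connected = ∀ x y → ∃ λ vs → Walk x y vs

  IsCycle : List (Fin n) → Set
  IsCycle vs = Σ (Fin n) λ x → Σ (Fin n) λ y →
    Walk x y vs × Unique vs × 3 ≤ length vs × Adj y x

  Acyclic : Set
  Acyclic = ∀ vs → ¬ IsCycle vs

  IsTree : Set
  IsTree = Connected × Acyclic

  ShortestPath : Fin n → Fin n → List (Fin n) → Set
  ShortestPath x y vs = Walk x y vs × (∀ ws → Walk x y ws → length vs ≤ length ws)

  IsDist : Fin n → Fin n → ℕ → Set
  IsDist x y d = ∃ λ vs → ShortestPath x y vs × length vs ≡ suc d

  IsEcc : Fin n → ℕ → Set
  IsEcc v e = (∀ u → ∃ λ d → IsDist v u d × d ≤ e) × (∃ λ u → IsDist v u e)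

  IsRadius : ℕ → Set
  IsRadius r = (∃ λ v → IsEcc v r) × (∀ v e → IsEcc v e → r ≤ e)

  IsDiameter : ℕ → Set
  IsDiameter d = (∃ λ v → IsEcc v d) × (∀ v e → IsEcc v e → e ≤ d)

  Visible : (Fin n → Set) → Fin n → Fin n → Set
  Visible S x y = ∃ λ vs → ShortestPath x y vs ×
    (∀ v → v ∈ vs → S v → (v ≡ x) ⊎ (v ≡ y))

  MutualVisibilitySet : (Fin n → Set) → Set
  MutualVisibilitySet S = ∀ x y → S x → S y → Visible S x y

  MVColoring : ℕ → Set
  MVColoring k = Σ (Fin n → Fin k) λ c →
    ∀ i → MutualVisibilitySet (λ v → c v ≡ i)

  IsChiMu : ℕ → Set
  IsChiMu k = MVColoring k × (∀ m → MVColoring m → k ≤ m)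

-- In a tree the path between two vertices is unique, so a vertex on the path from x to z
-- blocks x from z: a mutual-visibility set meets a path in at most two vertices, and a
-- diametral path, with diam + 1 vertices, needs at least (diam + 1) / 2 colours, rounded up.
-- Conversely, colour every vertex by its distance to the centre of a diametral path, a vertex
-- when diam is even and an edge when diam is odd. All inner vertices of the path between two
-- vertices of the same level are strictly closer to the centre, so each level is a
-- mutual-visibility set. The centre has eccentricity diam / 2 rounded up, which is the radius,
-- and the number of levels matches the lower bound.
module Submission where

open import Defs
open import Data.Empty using (⊥; ⊥-elim)
open import Data.Fin using (Fin; zero; suc; toℕ; fromℕ<)
open import Data.Fin.Properties using (_≟_; toℕ-fromℕ<)
open import Data.List using (List; []; _∷_; [_]; length; _++_; reverse; map; filter; allFin)
open import Data.List.Extrema.Nat using (argmax; f[xs]≤f[argmax])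
open import Data.List.Properties
  using (length-++; length-++-≤ʳ; length-reverse; length-map; unfold-reverse; reverse-++; ++-assoc)
open import Data.List.Membership.Propositional using (_∈_; _∉_)
open import Data.List.Membership.Propositional.Properties
  using (∈-++⁺ˡ; ∈-++⁺ʳ; ∈-++⁻; ∈-∃++; ∈-allFin)
import Data.List.Relation.Unary.All as All
open import Data.List.Relation.Unary.All.Properties using (¬Any⇒All¬)
open import Data.List.Relation.Unary.AllPairs using ([]; _∷_)
open import Data.List.Relation.Unary.Any using (here; there)
import Data.List.Relation.Unary.Any.Properties as Any
open import Data.List.Relation.Unary.Unique.Propositional using (Unique)
open import Data.List.Relation.Unary.Unique.Propositional.Properties using (++⁺; Unique[x∷xs]⇒x∉xs)
open import Data.Nat
  using (ℕ; zero; suc; pred; _+_; _*_; _%_; _/_; _⊓_; _≤_; _<_; z≤n; s≤s; _≤?_; >-nonZero)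
open import Data.Nat.DivMod using (m≡m%n+[m/n]*n)
open import Data.Nat.Properties hiding (_≟_)
open import Data.Product using (∃; ∃₂; _×_; _,_; proj₁; proj₂)
open import Data.Sum as Sum using (_⊎_; inj₁; inj₂)
open import Data.Unit using (⊤)
open import Function using (_∘_)
open import Relation.Binary.Definitions using (DecidableEquality)
open import Relation.Binary.PropositionalEquality hiding ([_])
open import Relation.Nullary using (¬_; yes; no)

module _ {A : Set} where

  Unique-∷ : ∀ {x : A} {xs} → x ∉ xs → Unique xs → Unique (x ∷ xs)
  Unique-∷ x∉xs u = ¬Any⇒All¬ _ x∉xs ∷ u

  Unique-tail : ∀ {x : A} {xs} → Unique (x ∷ xs) → Unique xs
  Unique-tail (_ ∷ u) = u

  Unique-++⁻ʳ : ∀ (xs : List A) {ys} → Unique (xs ++ ys) → Unique ys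
  Unique-++⁻ʳ [] u = u
  Unique-++⁻ʳ (_ ∷ xs) u = Unique-++⁻ʳ xs (Unique-tail u)

  Unique-++⁻ˡ : ∀ (xs : List A) {ys} → Unique (xs ++ ys) → Unique xs
  Unique-++⁻ˡ [] _ = []
  Unique-++⁻ˡ (_ ∷ xs) u =
    Unique-∷ (λ x∈xs → Unique[x∷xs]⇒x∉xs u (∈-++⁺ˡ x∈xs)) (Unique-++⁻ˡ xs (Unique-tail u))

  Unique-prefix : ∀ ps {v : A} {qs} → Unique (ps ++ v ∷ qs) → Unique (ps ++ [ v ])
  Unique-prefix ps {v} {qs} u = Unique-++⁻ˡ (ps ++ [ v ]) (subst Unique (sym (++-assoc ps [ v ] qs)) u)

  Unique-++⇒disjoint : ∀ (xs : List A) {ys v} → Unique (xs ++ ys) → v ∈ xs → v ∉ ys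
  Unique-++⇒disjoint (_ ∷ xs) u (here refl) v∈ys = Unique[x∷xs]⇒x∉xs u (∈-++⁺ʳ xs v∈ys)
  Unique-++⇒disjoint (_ ∷ xs) u (there v∈xs) = Unique-++⇒disjoint xs (Unique-tail u) v∈xs

  Unique-reverse : ∀ {xs : List A} → Unique xs → Unique (reverse xs)
  Unique-reverse {[]} u = []
  Unique-reverse {x ∷ xs} u rewrite unfold-reverse x xs =
    ++⁺ (Unique-reverse (Unique-tail u)) (Unique-∷ (λ ()) [])
        λ { (x∈ , here refl) → Unique[x∷xs]⇒x∉xs u (Any.reverse⁻ x∈) }

  reverse-++-∷ : ∀ (ps : List A) {x qs} → reverse (ps ++ x ∷ qs) ≡ reverse qs ++ x ∷ reverse ps
  reverse-++-∷ ps {x} {qs} = begin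
    reverse (ps ++ x ∷ qs)             ≡⟨ reverse-++ ps (x ∷ qs) ⟩
    reverse (x ∷ qs) ++ reverse ps     ≡⟨ cong (_++ reverse ps) (unfold-reverse x qs) ⟩
    (reverse qs ++ [ x ]) ++ reverse ps ≡⟨ ++-assoc (reverse qs) [ x ] (reverse ps) ⟩
    reverse qs ++ x ∷ reverse ps       ∎
    where open ≡-Reasoning

  split-at : ∀ (xs : List A) s t → length xs ≡ s + suc t →
             ∃₂ λ ps w → ∃ λ qs → xs ≡ ps ++ w ∷ qs × length ps ≡ s × length qs ≡ t
  split-at (x ∷ xs) zero t eq = [] , x , xs , refl , refl , suc-injective eq
  split-at (x ∷ xs) (suc s) t eq
    with ps , w , qs , refl , refl , #qs ← split-at xs s t (suc-injective eq) =
    x ∷ ps , w , qs , refl , refl , #qs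

  -- Meant for two paths out of a common vertex: their first steps differ.
  Diverge : List A → List A → Set
  Diverge (_ ∷ c ∷ _) (_ ∷ c′ ∷ _) = c ≢ c′
  Diverge _ _ = ⊤

  ∉⇒Diverge : ∀ {w c : A} xs {ys} → c ∉ ys → Diverge (w ∷ c ∷ xs) ys
  ∉⇒Diverge _ {_ ∷ _ ∷ _} c∉ys refl = c∉ys (there (here refl))
  ∉⇒Diverge _ {_ ∷ []} _ = _
  ∉⇒Diverge _ {[]} _ = _

  disjoint⇒Diverge : ∀ {w : A} xs {ys} → (∀ {v} → v ∈ xs → v ∉ ys) → Diverge (w ∷ xs) (w ∷ ys)
  disjoint⇒Diverge (_ ∷ _) {_ ∷ _} disjoint refl = disjoint (here refl) (here refl)
  disjoint⇒Diverge (_ ∷ _) {[]} _ = _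
  disjoint⇒Diverge [] _ = _

  Diverge-either : DecidableEquality A → ∀ {xs ys} → Diverge xs ys → ∀ zs →
                   Diverge xs zs ⊎ Diverge ys zs
  Diverge-either _≟_ {_ ∷ c ∷ _} {_ ∷ c′ ∷ _} c≢c′ (_ ∷ c″ ∷ _) with c ≟ c″
  ... | no c≢c″ = inj₁ c≢c″
  ... | yes refl = inj₂ (c≢c′ ∘ sym)
  Diverge-either _ {_ ∷ _ ∷ _} {_ ∷ _ ∷ _} _ (_ ∷ []) = inj₁ _
  Diverge-either _ {_ ∷ _ ∷ _} {_ ∷ _ ∷ _} _ [] = inj₁ _
  Diverge-either _ {_ ∷ _ ∷ _} {_ ∷ []} _ _ = inj₂ _
  Diverge-either _ {_ ∷ _ ∷ _} {[]} _ _ = inj₂ _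
  Diverge-either _ {_ ∷ []} _ _ = inj₁ _
  Diverge-either _ {[]} _ _ = inj₁ _

  ¬Diverge-++ : ∀ (ps : List A) {qs rs} → 2 ≤ length ps → ¬ Diverge (ps ++ qs) (ps ++ rs)
  ¬Diverge-++ (_ ∷ _ ∷ _) _ diverge = diverge refl
  ¬Diverge-++ (_ ∷ []) (s≤s ()) _

+-double-cancel-≤ : ∀ {m n} → m + m ≤ n + n → m ≤ n
+-double-cancel-≤ m+m≤n+n = ≮⇒≥ λ n<m → <⇒≱ (+-mono-< n<m n<m) m+m≤n+n

+-double-cancel-< : ∀ {m n} → m + m < n + n → m < n
+-double-cancel-< m+m<n+n = ≰⇒> λ n≤m → <⇒≱ m+m<n+n (+-mono-≤ n≤m n≤m)

m≡m%2+[m/2+m/2] : ∀ m → m ≡ m % 2 + (m / 2 + m / 2)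
m≡m%2+[m/2+m/2] m = begin
  m                             ≡⟨ m≡m%n+[m/n]*n m 2 ⟩
  m % 2 + m / 2 * 2             ≡⟨ cong (m % 2 +_) (*-comm (m / 2) 2) ⟩
  m % 2 + (m / 2 + (m / 2 + 0)) ≡⟨ cong (λ h → m % 2 + (m / 2 + h)) (+-identityʳ (m / 2)) ⟩
  m % 2 + (m / 2 + m / 2)       ∎
  where open ≡-Reasoning

count : ∀ {m} → Fin m → List (Fin m) → ℕ
count k ks = length (filter (_≟ k) ks)

drop-zeros : ∀ {m} → List (Fin (suc m)) → List (Fin m)
drop-zeros [] = []
drop-zeros (zero ∷ ks) = drop-zeros ks
drop-zeros (suc k ∷ ks) = k ∷ drop-zeros ks

length-drop-zeros : ∀ {m} (ks : List (Fin (suc m))) →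
                    length ks ≡ count zero ks + length (drop-zeros ks)
length-drop-zeros [] = refl
length-drop-zeros (zero ∷ ks) = cong suc (length-drop-zeros ks)
length-drop-zeros (suc k ∷ ks) =
  trans (cong suc (length-drop-zeros ks)) (sym (+-suc (count zero ks) _))

count-drop-zeros : ∀ {m} (k : Fin m) ks → count k (drop-zeros ks) ≡ count (suc k) ks
count-drop-zeros k [] = refl
count-drop-zeros k (zero ∷ ks) = count-drop-zeros k ks
count-drop-zeros k (suc j ∷ ks) with j ≟ k
... | yes _ = cong suc (count-drop-zeros k ks)
... | no _ = count-drop-zeros k ks

count≤2⇒length≤m+m : ∀ m (ks : List (Fin m)) → (∀ k → count k ks ≤ 2) → length ks ≤ m + m
count≤2⇒length≤m+m zero [] _ = z≤n
count≤2⇒length≤m+m (suc m) ks count≤2 = begin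
  length ks                              ≡⟨ length-drop-zeros ks ⟩
  count zero ks + length (drop-zeros ks) ≤⟨ +-mono-≤ (count≤2 zero) rest≤ ⟩
  2 + (m + m)                            ≡⟨ cong suc (sym (+-suc m m)) ⟩
  suc m + suc m                          ∎
  where
    open ≤-Reasoning
    rest≤ : length (drop-zeros ks) ≤ m + m
    rest≤ = count≤2⇒length≤m+m m (drop-zeros ks)
              (λ k → subst (_≤ 2) (sym (count-drop-zeros k ks)) (count≤2 (suc k)))

split-at-colour : ∀ {A : Set} {m} (c : A → Fin m) {k j} xs → suc j ≤ count k (map c xs) →
                  ∃₂ λ ps x → ∃ λ qs → xs ≡ ps ++ x ∷ qs × c x ≡ k × j ≤ count k (map c qs)
split-at-colour c {k} (x ∷ xs) h with c x ≟ k
... | yes cx≡k = [] , x , xs , refl , cx≡k , ≤-pred h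
... | no _ with ps , y , qs , refl , cy≡k , h′ ← split-at-colour c xs h =
  x ∷ ps , y , qs , refl , cy≡k , h′

module Walks {n : ℕ} (G : Graph n) where
  open Graph G using (Adj) renaming (sym to Adj-sym)
  open import Data.List.Membership.DecPropositional (_≟_ {n}) using (_∈?_)

  walk-start : ∀ {x y v vs} → Walk G x y (v ∷ vs) → v ≡ x
  walk-start here = refl
  walk-start (step _ _) = refl

  walk-uncons : ∀ {x y vs} → Walk G x y vs → ∃ λ qs → vs ≡ x ∷ qs
  walk-uncons here = [] , refl
  walk-uncons (step _ _) = _ , refl

  walk-start∈ : ∀ {x y vs} → Walk G x y vs → x ∈ vs
  walk-start∈ here = here refl
  walk-start∈ (step _ _) = here refl

  walk-end∈ : ∀ {x y vs} → Walk G x y vs → y ∈ vs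
  walk-end∈ here = here refl
  walk-end∈ (step _ w) = there (walk-end∈ w)

  walk-nonempty : ∀ {x y vs} → Walk G x y vs → 1 ≤ length vs
  walk-nonempty here = s≤s z≤n
  walk-nonempty (step _ _) = s≤s z≤n

  walk-first-edge : ∀ {x y v vs} → Walk G x y (x ∷ v ∷ vs) → Adj x v
  walk-first-edge (step e w) with refl ← walk-start w = e

  walk-≥2 : ∀ {x y vs} → x ≢ y → Walk G x y vs → 2 ≤ length vs
  walk-≥2 x≢y here = ⊥-elim (x≢y refl)
  walk-≥2 _ (step _ w) = s≤s (walk-nonempty w)

  walk-++ : ∀ {x y z ps qs} → Walk G x y ps → Walk G y z (y ∷ qs) → Walk G x z (ps ++ qs)
  walk-++ here w = w
  walk-++ (step e w₁) w₂ = step e (walk-++ w₁ w₂)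

  walk-reverse : ∀ {x y vs} → Walk G x y vs → Walk G y x (reverse vs)
  walk-reverse here = here
  walk-reverse {x} (step {vs = vs} e w) rewrite unfold-reverse x vs =
    walk-++ (walk-reverse w) (step (Adj-sym e) here)

  walk-split : ∀ {x y v} ps {qs} → Walk G x y (ps ++ v ∷ qs) →
               Walk G x v (ps ++ [ v ]) × Walk G v y (v ∷ qs)
  walk-split [] w with refl ← walk-start w = here , w
  walk-split (_ ∷ []) (step e w) with w₁ , w₂ ← walk-split [] w = step e w₁ , w₂
  walk-split (_ ∷ ps@(_ ∷ _)) (step e w) with w₁ , w₂ ← walk-split ps w = step e w₁ , w₂

  record Shortcut (x y : Fin n) (ws : List (Fin n)) : Set where
    field
      vertices : List (Fin n)
      walk     : Walk G x y vertices
      unique   : Unique vertices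
      ⊆walk    : ∀ {v} → v ∈ vertices → v ∈ ws
      shorter  : length vertices ≤ length ws

  shortcut : ∀ {x y ws} → Walk G x y ws → Shortcut x y ws
  shortcut {x} here = record
    { vertices = [ x ] ; walk = here ; unique = Unique-∷ (λ ()) []
    ; ⊆walk = λ v∈ → v∈ ; shorter = ≤-refl }
  shortcut {x} (step {vs = ws} e w) with shortcut w
  ... | record { vertices = vs ; walk = w′ ; unique = u ; ⊆walk = ⊆ws ; shorter = vs≤ } with x ∈? vs
  ... | no x∉vs = record
    { vertices = x ∷ vs ; walk = step e w′ ; unique = Unique-∷ x∉vs u
    ; ⊆walk = λ { (here refl) → here refl ; (there v∈) → there (⊆ws v∈) } ; shorter = s≤s vs≤ }
  ... | yes x∈vs with ps , qs , refl ← ∈-∃++ x∈vs = record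
    { vertices = x ∷ qs ; walk = proj₂ (walk-split ps w′) ; unique = Unique-++⁻ʳ ps u
    ; ⊆walk = λ { (here refl) → here refl ; (there v∈) → there (⊆ws (∈-++⁺ʳ ps (there v∈))) }
    ; shorter = m≤n⇒m≤1+n (≤-trans (length-++-≤ʳ (x ∷ qs) {ps}) vs≤) }

  module _ (acyclic : Acyclic G) where
    open Graph G using (irrefl)

    closed-by-edge : ∀ {x a} ps {qs} → Adj x a → Walk G x a (ps ++ [ a ]) → Unique (ps ++ [ a ]) →
                     (∀ {rs} → ps ++ a ∷ qs ≢ x ∷ a ∷ rs) → ⊥
    closed-by-edge [] e w _ _ with refl ← walk-start w = irrefl e
    closed-by-edge (_ ∷ []) e w _ fresh with refl ← walk-start w = fresh refl
    closed-by-edge {a = a} (_ ∷ _ ∷ ps) e w u _ =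
      acyclic _ (_ , _ , w , u , s≤s (s≤s (length-++-≤ʳ [ a ] {ps})) , Adj-sym e)

    leaves-differently : ∀ {x a b y zs} → Walk G b y zs → a ≢ b → ∀ {rs} → x ∷ zs ≢ x ∷ a ∷ rs
    leaves-differently w a≢b refl = a≢b (walk-start w)

    -- Prepend the vertices of ps to zs one by one; the first one already on zs closes a cycle.
    no-detour : ∀ {x a y zs ps} → Adj x a →
                Walk G x y zs → Unique zs → (∀ {rs} → zs ≢ x ∷ a ∷ rs) →
                Walk G a y ps → Unique ps → x ∉ ps → ⊥
    no-detour {a = a} {zs = zs} e wz uz fresh wp up x∉ps with a ∈? zs
    ... | yes a∈zs with ps , qs , refl ← ∈-∃++ a∈zs =
      closed-by-edge ps e (proj₁ (walk-split ps wz)) (Unique-prefix ps uz) fresh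
    ... | no a∉zs with wp
    ...   | here = a∉zs (walk-end∈ wz)
    ...   | step e′ wp′ =
      no-detour e′ (step (Adj-sym e) wz) (Unique-∷ a∉zs uz)
        (leaves-differently wz λ { refl → x∉ps (there (walk-start∈ wp′)) })
        wp′ (Unique-tail up) (Unique[x∷xs]⇒x∉xs up)

    unique-walks-equal : ∀ {x y ps qs} → Walk G x y ps → Unique ps → Walk G x y qs → Unique qs →
                         ps ≡ qs
    unique-walks-equal here _ here _ = refl
    unique-walks-equal here _ (step _ w) u = ⊥-elim (Unique[x∷xs]⇒x∉xs u (walk-end∈ w))
    unique-walks-equal (step _ w) u here _ = ⊥-elim (Unique[x∷xs]⇒x∉xs u (walk-end∈ w))
    unique-walks-equal (step {y = a} e w) u (step {y = b} e′ w′) u′ with a ≟ b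
    ... | yes refl = cong (_ ∷_) (unique-walks-equal w (Unique-tail u) w′ (Unique-tail u′))
    ... | no a≢b = ⊥-elim (no-detour e (step e′ w′) u′ (leaves-differently w′ a≢b)
                                      w (Unique-tail u) (Unique[x∷xs]⇒x∉xs u))

module Tree {n : ℕ} (T : Graph n) (connected : Connected T) (acyclic : Acyclic T) where
  open Graph T using (Adj; irrefl) renaming (sym to Adj-sym)
  open Walks T
  open import Data.List.Membership.DecPropositional (_≟_ {n}) using (_∈?_)

  private
    shortcut-of : ∀ x y → Shortcut x y (proj₁ (connected x y))
    shortcut-of x y = shortcut (proj₂ (connected x y))

  path : Fin n → Fin n → List (Fin n)
  path x y = Shortcut.vertices (shortcut-of x y)

  path-walk : ∀ x y → Walk T x y (path x y)
  path-walk x y = Shortcut.walk (shortcut-of x y)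

  path-unique : ∀ x y → Unique (path x y)
  path-unique x y = Shortcut.unique (shortcut-of x y)

  unique-walk≡path : ∀ {x y ps} → Walk T x y ps → Unique ps → ps ≡ path x y
  unique-walk≡path w u = unique-walks-equal acyclic w u (path-walk _ _) (path-unique _ _)

  path-⊆-walk : ∀ {x y ws v} → Walk T x y ws → v ∈ path x y → v ∈ ws
  path-⊆-walk w v∈ = ⊆walk (subst (_ ∈_) (sym (unique-walk≡path walk unique)) v∈)
    where open Shortcut (shortcut w)

  -- The number of vertices on the path: the distance plus one.
  #path : Fin n → Fin n → ℕ
  #path x y = length (path x y)

  #path-≤-walk : ∀ {x y ws} → Walk T x y ws → #path x y ≤ length ws
  #path-≤-walk w = subst (_≤ _) (cong length (unique-walk≡path walk unique)) shorter
    where open Shortcut (shortcut w)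

  #path≥2 : ∀ {x y} → x ≢ y → 2 ≤ #path x y
  #path≥2 x≢y = walk-≥2 x≢y (path-walk _ _)

  path-reverse : ∀ x y → path y x ≡ reverse (path x y)
  path-reverse x y = sym (unique-walk≡path (walk-reverse (path-walk x y)) (Unique-reverse (path-unique x y)))

  #path-sym : ∀ x y → #path x y ≡ #path y x
  #path-sym x y = trans (sym (length-reverse (path x y))) (cong length (sym (path-reverse x y)))

  ∈-path-sym : ∀ {x y v} → v ∈ path x y → v ∈ path y x
  ∈-path-sym v∈ = subst (_ ∈_) (sym (path-reverse _ _)) (Any.reverse⁺ v∈)

  path-split : ∀ {x y v} ps {qs} → path x y ≡ ps ++ v ∷ qs →
               path x v ≡ ps ++ [ v ] × path v y ≡ v ∷ qs
  path-split ps eq with w₁ , w₂ ← walk-split ps (subst (Walk T _ _) eq (path-walk _ _)) =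
    sym (unique-walk≡path w₁ (Unique-prefix ps u)) , sym (unique-walk≡path w₂ (Unique-++⁻ʳ ps u))
    where u = subst Unique eq (path-unique _ _)

  path-reverse-split : ∀ {a b w} ps {qs} → path a b ≡ ps ++ w ∷ qs →
                       path b a ≡ reverse qs ++ w ∷ reverse ps
  path-reverse-split {a} {b} ps eq = trans (path-reverse a b) (trans (cong reverse eq) (reverse-++-∷ ps))

  path-prefix : ∀ {w y p} → p ∈ path w y → ∃ λ qs → path w y ≡ path w p ++ qs
  path-prefix {p = p} p∈ with ps , qs , eq ← ∈-∃++ p∈ =
    qs , trans eq (trans (sym (++-assoc ps [ p ] qs)) (cong (_++ qs) (sym (proj₁ (path-split ps eq)))))

  path-position : ∀ {a b w} ps {qs} → path a b ≡ ps ++ w ∷ qs →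
                  #path a w ≡ suc (length ps) × #path w b ≡ suc (length qs)
  path-position ps eq with eq₁ , eq₂ ← path-split ps eq =
    trans (cong length eq₁) (trans (length-++ ps) (+-comm (length ps) 1)) , cong length eq₂

  path-infix : ∀ {a b x z} ps qs {ss} → path a b ≡ ps ++ x ∷ qs ++ z ∷ ss →
               path x z ≡ x ∷ qs ++ [ z ]
  path-infix ps qs eq = proj₁ (path-split (_ ∷ qs) (proj₂ (path-split ps eq)))

  #path-split : ∀ {x y v} → v ∈ path x y → suc (#path x y) ≡ #path x v + #path v y
  #path-split {x} {y} {v} v∈ with ps , qs , eq ← ∈-∃++ v∈ with eq₁ , eq₂ ← path-split ps eq = begin
    suc (#path x y)
      ≡⟨ cong (suc ∘ length) (trans eq (sym (++-assoc ps [ v ] qs))) ⟩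
    suc (length ((ps ++ [ v ]) ++ qs))      ≡⟨ cong suc (length-++ (ps ++ [ v ])) ⟩
    suc (length (ps ++ [ v ]) + length qs)  ≡⟨ sym (+-suc _ _) ⟩
    length (ps ++ [ v ]) + length (v ∷ qs)
      ≡⟨ sym (cong₂ _+_ (cong length eq₁) (cong length eq₂)) ⟩
    #path x v + #path v y                   ∎
    where open ≡-Reasoning

  ∈-path⇒closer : ∀ {x y v} → v ∈ path x y → v ≢ x → #path v y < #path x y
  ∈-path⇒closer {x} {y} {v} v∈ v≢x = ≤-pred (begin
    2 + #path v y          ≤⟨ +-monoˡ-≤ (#path v y) (#path≥2 (v≢x ∘ sym)) ⟩
    #path x v + #path v y  ≡⟨ sym (#path-split v∈) ⟩
    suc (#path x y)        ∎)
    where open ≤-Reasoning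

  ∈-path-antisym : ∀ {v w u} → w ∈ path v u → v ∈ path w u → v ≡ w
  ∈-path-antisym {v} {w} w∈ v∈ with v ≟ w
  ... | yes v≡w = v≡w
  ... | no v≢w = ⊥-elim (<-asym (∈-path⇒closer w∈ (v≢w ∘ sym)) (∈-path⇒closer v∈ v≢w))

  path-⊆-via : ∀ {x y v} w → v ∈ path x y → v ∈ path x w ⊎ v ∈ path w y
  path-⊆-via {x} {y} w v∈ with qs , eq ← walk-uncons (path-walk w y) =
    Sum.map₂ (λ v∈qs → subst (_ ∈_) (sym eq) (there v∈qs)) (∈-++⁻ (path x w) (path-⊆-walk walk v∈))
    where walk = walk-++ (path-walk x w) (subst (Walk T w y) eq (path-walk w y))

  path-⊆-via-edge : ∀ {x y v w w′} → Adj w w′ → v ∈ path x y → v ∈ path x w ⊎ v ∈ path w′ y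
  path-⊆-via-edge {x} {y} {w = w} {w′} e v∈ =
    ∈-++⁻ (path x w) (path-⊆-walk (walk-++ (path-walk x _) (step e (path-walk w′ y))) v∈)

  path-⊆-via-joined : ∀ {x y v w w′} → w ≡ w′ ⊎ Adj w w′ → v ∈ path x y →
                      v ∈ path x w ⊎ v ∈ path w′ y
  path-⊆-via-joined (inj₁ refl) = path-⊆-via _
  path-⊆-via-joined (inj₂ e) = path-⊆-via-edge e

  #path-triangle : ∀ x y z → suc (#path x z) ≤ #path x y + #path y z
  #path-triangle x y z with qs , eq ← walk-uncons (path-walk y z) = begin
    suc (#path x z)                 ≤⟨ s≤s (#path-≤-walk walk) ⟩
    suc (length (path x y ++ qs))   ≡⟨ cong suc (length-++ (path x y)) ⟩
    suc (#path x y + length qs)     ≡⟨ sym (+-suc _ _) ⟩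
    #path x y + length (y ∷ qs)     ≡⟨ cong (λ vs → #path x y + length vs) (sym eq) ⟩
    #path x y + #path y z           ∎
    where
      open ≤-Reasoning
      walk = walk-++ (path-walk x y) (subst (Walk T y z) eq (path-walk y z))

  #path-adjacent : ∀ {x y} → Adj x y → ∀ u → #path x u ≤ suc (#path y u)
  #path-adjacent {x} {y} e u =
    ≤-pred (≤-trans (#path-triangle x y u) (+-monoˡ-≤ (#path y u) (#path-≤-walk (step e here))))

  IsDist⇒#path : ∀ {x y e} → IsDist T x y e → #path x y ≡ suc e
  IsDist⇒#path (vs , (w , shortest) , length≡) =
    trans (≤-antisym (#path-≤-walk w) (shortest _ (path-walk _ _))) length≡

  IsDist-path : ∀ x y → ∃ (IsDist T x y)
  IsDist-path x y with qs , eq ← walk-uncons (path-walk x y) =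
    length qs , path x y , (path-walk x y , λ _ → #path-≤-walk) , cong length eq

  farthest : Fin n → Fin n
  farthest v = argmax (#path v) v (allFin n)

  #path≤farthest : ∀ v u → #path v u ≤ #path v (farthest v)
  #path≤farthest v u = All.lookup (f[xs]≤f[argmax] v (allFin n)) (∈-allFin u)

  IsEcc-exists : ∀ v → ∃ (IsEcc T v)
  IsEcc-exists v with e , isDist ← IsDist-path v (farthest v) = e , bounded , farthest v , isDist
    where
      bounded : ∀ u → ∃ λ d → IsDist T v u d × d ≤ e
      bounded u with d , isDist′ ← IsDist-path v u =
        d , isDist′ ,
        ≤-pred (subst₂ _≤_ (IsDist⇒#path isDist′) (IsDist⇒#path isDist) (#path≤farthest v u))

  IsEcc⇒#path≤ : ∀ {v e} → IsEcc T v e → ∀ u → #path v u ≤ suc e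
  IsEcc⇒#path≤ (bounded , _) u with d , isDist , d≤e ← bounded u =
    subst (_≤ _) (sym (IsDist⇒#path isDist)) (s≤s d≤e)

  diameter-bound : ∀ {d} → IsDiameter T d → ∀ x y → #path x y ≤ suc d
  diameter-bound (_ , maximal) x y with e , ecc ← IsEcc-exists x =
    ≤-trans (IsEcc⇒#path≤ ecc y) (s≤s (maximal x e ecc))

  diametral-pair : ∀ {d} → IsDiameter T d → ∃₂ λ a b → #path a b ≡ suc d
  diametral-pair ((a , _ , b , isDist) , _) = a , b , IsDist⇒#path isDist

  radius-≤ : ∀ {r w s} → IsRadius T r → (∀ u → #path w u ≤ suc s) → r ≤ s
  radius-≤ {w = w} (_ , minimal) bound with e , ecc@(_ , u , isDist) ← IsEcc-exists w =
    ≤-trans (minimal w e ecc) (≤-pred (subst (_≤ _) (IsDist⇒#path isDist) (bound u)))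

  diameter≤2·radius : ∀ {r d} → IsRadius T r → IsDiameter T d → d ≤ r + r
  diameter≤2·radius {r} {d} ((c , ecc) , _) diam
    with a , b , #ab ← diametral-pair diam = ≤-pred (≤-pred (begin
    2 + d                    ≡⟨ cong suc (sym #ab) ⟩
    suc (#path a b)          ≤⟨ #path-triangle a c b ⟩
    #path a c + #path c b    ≤⟨ +-mono-≤ (subst (_≤ _) (#path-sym c a) (IsEcc⇒#path≤ ecc a))
                                         (IsEcc⇒#path≤ ecc b) ⟩
    suc r + suc r            ≡⟨ cong suc (+-suc r r) ⟩
    2 + (r + r)              ∎))
    where open ≤-Reasoning

  interior-vertex-blocks : ∀ {S x z y qs} → path x z ≡ x ∷ qs ++ [ z ] → y ∈ qs → S y →
                           ¬ Visible T S x z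
  interior-vertex-blocks {x = x} {z} {y} {qs} eq y∈qs Sy (_ , (w , _) , only-ends)
    with only-ends y (path-⊆-walk w (subst (y ∈_) (sym eq) (there (∈-++⁺ˡ y∈qs)))) Sy
  ... | inj₁ refl = Unique[x∷xs]⇒x∉xs (subst Unique eq (path-unique x z)) (∈-++⁺ˡ y∈qs)
  ... | inj₂ refl =
    Unique-++⇒disjoint qs (Unique-tail (subst Unique eq (path-unique x z))) y∈qs (here refl)

  colouring-bound : ∀ {m} → MVColoring T m → ∀ a b → #path a b ≤ m + m
  colouring-bound {m} (c , visible) a b =
    subst (_≤ m + m) (length-map c (path a b)) (count≤2⇒length≤m+m m (map c (path a b)) count≤2)
    where
      count≤2 : ∀ k → count k (map c (path a b)) ≤ 2
      count≤2 k with 3 ≤? count k (map c (path a b))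
      ... | no 3≰ = ≤-pred (≰⇒> 3≰)
      ... | yes 3≤ with ps , x , r₁ , eq , cx , h₁ ← split-at-colour c (path a b) 3≤
                   with qs , y , r₂ , refl , cy , h₂ ← split-at-colour c r₁ h₁
                   with rs , z , ss , refl , cz , _ ← split-at-colour c r₂ h₂ =
        ⊥-elim (interior-vertex-blocks (path-infix ps (qs ++ y ∷ rs) (trans eq reassociate))
                                       (∈-++⁺ʳ qs (here refl)) cy (visible k x z cx cz))
        where
          reassociate : ps ++ x ∷ qs ++ y ∷ rs ++ z ∷ ss ≡ ps ++ x ∷ (qs ++ y ∷ rs) ++ z ∷ ss
          reassociate = cong (λ l → ps ++ x ∷ l) (sym (++-assoc qs (y ∷ rs) (z ∷ ss)))

  LevelsVisible : (Fin n → ℕ) → Set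
  LevelsVisible f = ∀ {x y v} → f x ≡ f y → v ∈ path x y → f v ≡ f x → v ≡ x ⊎ v ≡ y

  level-colouring : ∀ t (f : Fin n → ℕ) → (∀ v → 1 ≤ f v) → (∀ v → f v ≤ suc t) →
                    LevelsVisible f → MVColoring T (suc t)
  level-colouring t f f≥1 f≤ visible = colour , λ k x y cx cy →
    path x y , (path-walk x y , λ _ → #path-≤-walk) ,
    λ v v∈ cv → visible (same-level (trans cx (sym cy))) v∈ (same-level (trans cv (sym cx)))
    where
      colour : Fin n → Fin (suc t)
      colour v = fromℕ< (s≤s (pred-mono-≤ (f≤ v)))
      f≡suc-pred : ∀ v → f v ≡ suc (pred (f v))
      f≡suc-pred v = sym (suc-pred (f v) {{>-nonZero (f≥1 v)}})
      same-level : ∀ {x y} → colour x ≡ colour y → f x ≡ f y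
      same-level {x} {y} eq = begin
        f x                   ≡⟨ f≡suc-pred x ⟩
        suc (pred (f x))      ≡⟨ cong suc (sym (toℕ-fromℕ< _)) ⟩
        suc (toℕ (colour x))  ≡⟨ cong (suc ∘ toℕ) eq ⟩
        suc (toℕ (colour y))  ≡⟨ cong suc (toℕ-fromℕ< _) ⟩
        suc (pred (f y))      ≡⟨ sym (f≡suc-pred y) ⟩
        f y                   ∎
        where open ≡-Reasoning

  Attains : (Fin n → ℕ) → Fin n → Fin n → Set
  Attains f w x = (∀ v → f v ≤ #path w v) × #path w x ≡ f x

  attains⇒inside-lower : ∀ {f w x v} → Attains f w x → v ∈ path x w → v ≢ x → f v < f x
  attains⇒inside-lower {f} {w} {x} {v} (f≤ , attained) v∈ v≢x = begin-strict
    f v          ≤⟨ f≤ v ⟩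
    #path w v    ≡⟨ #path-sym w v ⟩
    #path v w    <⟨ ∈-path⇒closer v∈ v≢x ⟩
    #path x w    ≡⟨ #path-sym x w ⟩
    #path w x    ≡⟨ attained ⟩
    f x          ∎
    where open ≤-Reasoning

  levels-visible : ∀ f → (∀ x y → ∃₂ λ wx wy → Attains f wx x × Attains f wy y ×
                                   (∀ {v} → v ∈ path x y → v ∈ path x wx ⊎ v ∈ path y wy)) →
                   LevelsVisible f
  levels-visible f centres {x} {y} {v} fx≡fy v∈ fv≡fx with centres x y
  ... | wx , wy , att-x , att-y , cover with cover v∈ | v ≟ x | v ≟ y
  ...   | _ | yes v≡x | _ = inj₁ v≡x
  ...   | _ | _ | yes v≡y = inj₂ v≡y
  ...   | inj₁ v∈xw | no v≢x | _ = ⊥-elim (<-irrefl fv≡fx (attains⇒inside-lower att-x v∈xw v≢x))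
  ...   | inj₂ v∈yw | _ | no v≢y =
    ⊥-elim (<-irrefl (trans fv≡fx fx≡fy) (attains⇒inside-lower att-y v∈yw v≢y))

  -- Colour by the distance to {w₁, w₂}; w₁ ≡ w₂ is the case of a central vertex.
  centre-colouring : ∀ {w₁ w₂} t → w₁ ≡ w₂ ⊎ Adj w₁ w₂ →
                     (∀ u → #path w₁ u ⊓ #path w₂ u ≤ suc t) → MVColoring T (suc t)
  centre-colouring {w₁} {w₂} t joined bound = level-colouring t f f≥1 bound (levels-visible f centres)
    where
      f : Fin n → ℕ
      f v = #path w₁ v ⊓ #path w₂ v
      f≥1 : ∀ v → 1 ≤ f v
      f≥1 v = ⊓-glb (walk-nonempty (path-walk w₁ v)) (walk-nonempty (path-walk w₂ v))
      Centre : Fin n → Set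
      Centre w = w ≡ w₁ ⊎ w ≡ w₂
      f≤ : ∀ {w} → Centre w → ∀ v → f v ≤ #path w v
      f≤ (inj₁ refl) v = m⊓n≤m _ _
      f≤ (inj₂ refl) v = m⊓n≤n _ _
      nearest : ∀ x → ∃ λ w → Centre w × #path w x ≡ f x
      nearest x with #path w₁ x ≤? #path w₂ x
      ... | yes ≤ = w₁ , inj₁ refl , sym (m≤n⇒m⊓n≡m ≤)
      ... | no ≰ = w₂ , inj₂ refl , sym (m≥n⇒m⊓n≡n (<⇒≤ (≰⇒> ≰)))
      centres-joined : ∀ {w w′} → Centre w → Centre w′ → w ≡ w′ ⊎ Adj w w′
      centres-joined (inj₁ refl) (inj₁ refl) = inj₁ refl
      centres-joined (inj₂ refl) (inj₂ refl) = inj₁ refl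
      centres-joined (inj₁ refl) (inj₂ refl) = joined
      centres-joined (inj₂ refl) (inj₁ refl) = Sum.map sym Adj-sym joined
      centres : ∀ x y → ∃₂ λ wx wy → Attains f wx x × Attains f wy y ×
                                     (∀ {v} → v ∈ path x y → v ∈ path x wx ⊎ v ∈ path y wy)
      centres x y with wx , cx , ex ← nearest x | wy , cy , ey ← nearest y =
        wx , wy , (f≤ cx , ex) , (f≤ cy , ey) ,
        λ v∈ → Sum.map₂ ∈-path-sym (path-⊆-via-joined (centres-joined cx cy) v∈)

  Diverge⇒meet-at-start : ∀ {w y u p} → Diverge (path w y) (path w u) →
                          p ∈ path w y → p ∈ path w u → p ≡ w
  Diverge⇒meet-at-start {w} {p = p} diverge p∈y p∈u with p ≟ w
  ... | yes p≡w = p≡w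
  ... | no p≢w with qs , eq ← path-prefix p∈y | rs , eq′ ← path-prefix p∈u =
    ⊥-elim (¬Diverge-++ (path w p) (#path≥2 (p≢w ∘ sym)) (subst₂ Diverge eq eq′ diverge))

  Diverge⇒∈-path : ∀ {w y u} → Diverge (path w y) (path w u) → w ∈ path y u
  Diverge⇒∈-path {w} {y} {u} diverge with qs , eq ← walk-uncons (path-walk w u) =
    subst (w ∈_) (unique-walk≡path walk unique) (∈-++⁺ˡ (walk-end∈ (path-walk y w)))
    where
      walk : Walk T y u (path y w ++ qs)
      walk = walk-++ (path-walk y w) (subst (Walk T w u) eq (path-walk w u))
      w∉qs : w ∉ qs
      w∉qs = Unique[x∷xs]⇒x∉xs (subst Unique eq (path-unique w u))
      disjoint : ∀ {p} → p ∈ path y w × p ∈ qs → ⊥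
      disjoint (p∈yw , p∈qs)
        with refl ← Diverge⇒meet-at-start diverge (∈-path-sym p∈yw) (subst (_ ∈_) (sym eq) (there p∈qs))
        = w∉qs p∈qs
      unique : Unique (path y w ++ qs)
      unique = ++⁺ (path-unique y w) (Unique-tail (subst Unique eq (path-unique w u))) disjoint

  beyond-neighbour : ∀ {w c y u xs} → path w y ≡ w ∷ c ∷ xs → c ∉ path w u → w ∈ path y u
  beyond-neighbour {u = u} {xs} eq c∉ =
    Diverge⇒∈-path (subst (λ l → Diverge l (path _ u)) (sym eq) (∉⇒Diverge xs c∉))

  far-side-bound : ∀ {w y u t s} → w ∈ path y u → #path y w ≡ suc t → #path y u ≤ suc (t + s) →
                   #path w u ≤ suc s
  far-side-bound {w} {y} {u} {t} {s} w∈ #yw bound = +-cancelˡ-≤ (suc t) _ _ (begin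
    suc t + #path w u      ≡⟨ cong (_+ #path w u) (sym #yw) ⟩
    #path y w + #path w u  ≡⟨ sym (#path-split w∈) ⟩
    suc (#path y u)        ≤⟨ s≤s bound ⟩
    suc (suc (t + s))      ≡⟨ cong suc (sym (+-suc t s)) ⟩
    suc t + suc s          ∎)
    where open ≤-Reasoning

  central-vertex : ∀ {t a b} → (∀ x y → #path x y ≤ suc (t + t)) → #path a b ≡ suc (t + t) →
                   ∃ λ w → ∀ u → #path w u ≤ suc t
  central-vertex {t} {a} {b} bound #ab
    with ps , w , qs , eq , #ps , #qs ← split-at (path a b) t t (trans #ab (sym (+-suc t t))) =
    w , λ u → Sum.[ far-side-bound′ a #aw , far-side-bound′ b #bw ]′
                (Diverge-either _≟_ diverge (path w u))
    where
      #aw : #path a w ≡ suc t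
      #aw = trans (proj₁ (path-position ps eq)) (cong suc #ps)
      #bw : #path b w ≡ suc t
      #bw = trans (#path-sym b w) (trans (proj₂ (path-position ps eq)) (cong suc #qs))
      far-side-bound′ : ∀ y {u} → #path y w ≡ suc t → Diverge (path w y) (path w u) →
                        #path w u ≤ suc t
      far-side-bound′ y {u} #yw d = far-side-bound (Diverge⇒∈-path d) #yw (bound y u)
      diverge : Diverge (path w a) (path w b)
      diverge = subst₂ Diverge (sym (proj₂ (path-split (reverse qs) (path-reverse-split ps eq))))
                               (sym (proj₂ (path-split ps eq)))
                  (disjoint⇒Diverge (reverse ps) λ v∈ v∈qs →
                     Unique-++⇒disjoint ps (subst Unique eq (path-unique a b))
                                        (Any.reverse⁻ v∈) (there v∈qs))

  central-edge : ∀ {t a b} → (∀ x y → #path x y ≤ suc (suc (t + t))) →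
                 #path a b ≡ suc (suc (t + t)) →
                 ∃₂ λ w₁ w₂ → Adj w₁ w₂ × (∀ u → #path w₁ u ≤ suc t ⊎ #path w₂ u ≤ suc t)
  central-edge {t} {a} {b} bound #ab
    with split-at (path a b) t (suc t) (trans #ab (sym (trans (+-suc t (suc t)) (cong suc (+-suc t t)))))
  ... | ps , w₁ , [] , _ , _ , ()
  ... | ps , w₁ , w₂ ∷ qs , eq , #ps , #qs = w₁ , w₂ , edge , nearer
    where
      w₁b : path w₁ b ≡ w₁ ∷ w₂ ∷ qs
      w₁b = proj₂ (path-split ps eq)
      edge : Adj w₁ w₂
      edge = walk-first-edge (subst (Walk T w₁ b) w₁b (path-walk w₁ b))
      eq′ : path a b ≡ (ps ++ [ w₁ ]) ++ w₂ ∷ qs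
      eq′ = trans eq (sym (++-assoc ps [ w₁ ] (w₂ ∷ qs)))
      w₂a : path w₂ a ≡ w₂ ∷ w₁ ∷ reverse ps
      w₂a = trans (proj₂ (path-split (reverse qs) (path-reverse-split (ps ++ [ w₁ ]) eq′)))
                  (cong (w₂ ∷_) (reverse-++-∷ ps))
      #bw₁ : #path b w₁ ≡ suc (suc t)
      #bw₁ = trans (#path-sym b w₁) (trans (proj₂ (path-position ps eq)) (cong suc #qs))
      #aw₂ : #path a w₂ ≡ suc (suc t)
      #aw₂ = trans (proj₁ (path-position (ps ++ [ w₁ ]) eq′))
                   (cong suc (trans (length-++ ps) (trans (+-comm (length ps) 1) (cong suc #ps))))
      -- u lies beyond w₁ seen from b, unless its path from w₁ starts with w₂;
      -- then it lies beyond w₂ seen from a.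
      nearer : ∀ u → #path w₁ u ≤ suc t ⊎ #path w₂ u ≤ suc t
      nearer u with w₂ ∈? path w₁ u
      ... | no w₂∉ = inj₁ (far-side-bound (beyond-neighbour w₁b w₂∉) #bw₁ (bound b u))
      ... | yes w₂∈ = inj₂ (far-side-bound (beyond-neighbour w₂a w₁∉) #aw₂ (bound a u))
        where
          w₁∉ : w₁ ∉ path w₂ u
          w₁∉ w₁∈ with refl ← ∈-path-antisym w₂∈ w₁∈ = irrefl edge

  χμ-of-even-diameter : ∀ {r t} → IsRadius T r → IsDiameter T (t + t) → IsChiMu T (suc r)
  χμ-of-even-diameter {r} {t} radius diameter =
    let a , b , #ab = diametral-pair diameter
        w , w-bound = central-vertex (diameter-bound diameter) #ab
        r≡t = ≤-antisym (radius-≤ radius w-bound)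
                        (+-double-cancel-≤ (diameter≤2·radius radius diameter))
    in subst (IsChiMu T ∘ suc) (sym r≡t)
         ( centre-colouring t (inj₁ refl) (λ u → subst (_≤ suc t) (sym (⊓-idem _)) (w-bound u))
         , λ m colouring → +-double-cancel-< (subst (_≤ m + m) #ab (colouring-bound colouring a b)))

  χμ-of-odd-diameter : ∀ {r t} → IsRadius T r → IsDiameter T (suc (t + t)) → IsChiMu T r
  χμ-of-odd-diameter {r} {t} radius diameter =
    let a , b , #ab = diametral-pair diameter
        w₁ , w₂ , edge , nearer = central-edge (diameter-bound diameter) #ab
        w₁-bound u = Sum.[ m≤n⇒m≤1+n , ≤-trans (#path-adjacent edge u) ∘ s≤s ]′ (nearer u)
        r≡1+t = ≤-antisym (radius-≤ radius w₁-bound)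
                          (+-double-cancel-< (diameter≤2·radius radius diameter))
        min-bound u = Sum.[ ≤-trans (m⊓n≤m _ _) , ≤-trans (m⊓n≤n _ _) ]′ (nearer u)
    in subst (IsChiMu T) (sym r≡1+t)
         ( centre-colouring t (inj₂ edge) min-bound
         , λ m colouring →
             +-double-cancel-< (≤-trans (n≤1+n _) (subst (_≤ m + m) #ab (colouring-bound colouring a b))))

corollary5p2 : ∀ {n : ℕ} (T : Graph n) → IsTree T →
    ∀ (r d : ℕ) → IsRadius T r → IsDiameter T d →
      ((d % 2 ≡ 0 → IsChiMu T (suc r)) × (d % 2 ≡ 1 → IsChiMu T r))
corollary5p2 T (connected , acyclic) r d radius diameter = even , odd
  where
    open Tree T connected acyclic
    d≡parity+2⌊d/2⌋ : ∀ {p} → d % 2 ≡ p → d ≡ p + (d / 2 + d / 2)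
    d≡parity+2⌊d/2⌋ d%2≡p = trans (m≡m%2+[m/2+m/2] d) (cong (_+ (d / 2 + d / 2)) d%2≡p)
    even : d % 2 ≡ 0 → IsChiMu T (suc r)
    even d%2≡0 =
      χμ-of-even-diameter {t = d / 2} radius (subst (IsDiameter T) (d≡parity+2⌊d/2⌋ d%2≡0) diameter)
    odd : d % 2 ≡ 1 → IsChiMu T r
    odd d%2≡1 =
      χμ-of-odd-diameter {t = d / 2} radius (subst (IsDiameter T) (d≡parity+2⌊d/2⌋ d%2≡1) diameter)
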